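{- Let $q$ be an odd prime power and consider the directed graph $\mathcal{J}_{\mathbb{F}_q}$ defined below. Suppose $(a,b)\to(c,d)\to(e,f)$ is a directed path in $\mathcal{J}_{\mathbb{F}_q}$. Then $(a,b)$ is a square vertex if and only if $(e,f)$ is a square vertex.
   Context: $\mathbb{F}_q$ is the finite field with $q$ elements, $q$ odd. $\phi_q\colon \mathbb{F}_q^\times\to\{\pm1\}$ is the quadratic character: $\phi_q(a)=1$ if $a$ is a square in $\mathbb{F}_q^\times$ and $-1$ otherwise. The directed graph $\mathcal{J}_{\mathbb{F}_q}=(V,E)$ has vertex set $V=\{(a,b)\in(\mathbb{F}_q^\times)^2 : \phi_q(ab)=1,\ a\neq \pm b\}$, and for $(a,b),(c,d)\in V$ there is an edge $(a,b)\to(c,d)$ if and only if $c=\frac{a+b}{2}$ and $d^2=ab$. A vertex $(a,b)\in V$ is a square vertex if both $a$ and $b$ are squares in $\mathbb{F}_q^\times$; all other vertices are non-square vertices. -}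

module Defs where

open import Level using (0ℓ)
open import Algebra.Bundles using (CommutativeRing)
open import Data.List using (List; length)
open import Data.List.Relation.Unary.Any using (Any)
open import Data.List.Relation.Unary.AllPairs using (AllPairs)
open import Data.Nat using (ℕ)
open import Data.Product using (Σ; ∃; _×_)
open import Relation.Nullary using (¬_)
open import Relation.Binary.Definitions using (Decidable)

record FiniteField : Set₁ where
  field
    ring : CommutativeRing 0ℓ 0ℓ
  open CommutativeRing ring
  field
    _≟_      : Decidable _≈_
    0≉1      : ¬ (0# ≈ 1#)
    inverse  : ∀ x → ¬ (x ≈ 0#) → ∃ λ y → x * y ≈ 1#
    elems    : List Carrier
    complete : ∀ x → Any (x ≈_) elems
    distinct : AllPairs (λ x y → ¬ (x ≈ y)) elems

  card : ℕ
  card = length elems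

module JGraph (F : FiniteField) where
  open FiniteField F
  open CommutativeRing ring

  NonZero : Carrier → Set
  NonZero a = ¬ (a ≈ 0#)

  -- a is a square in F_q^×  (i.e. a ≠ 0 and φ_q(a) = 1)
  IsSquare : Carrier → Set
  IsSquare a = NonZero a × ∃ λ t → t * t ≈ a

  two : Carrier
  two = 1# + 1#

  Vertex : Carrier → Carrier → Set
  Vertex a b = NonZero a × NonZero b × IsSquare (a * b)
             × ¬ (a ≈ b) × ¬ (a ≈ - b)

  -- edge (a,b) → (c,d) between vertices: c = (a+b)/2 (written 2c = a+b,
  -- equivalent since 2 is invertible for odd q) and d² = ab
  Edge : Carrier → Carrier → Carrier → Carrier → Set
  Edge a b c d = Vertex a b × Vertex c d × (two * c ≈ a + b) × (d * d ≈ a * b)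

  SquareVertex : Carrier → Carrier → Set
  SquareVertex a b = IsSquare a × IsSquare b

{-# OPTIONS --safe #-}
-- From 2c = a + b, 2e = c + d and d² = ab one gets
--   4ae = 2a(c + d) = a² + ab + 2ad = (a + d)²,
-- and 2 ≠ 0 because 2c = a + b while a ≠ -b.  Hence, when a is a nonzero
-- square, e = ((a + d) / 2√a)² is a square, and symmetrically a is a square
-- when e is.  The second coordinates follow: b = ab / a and f = ef / e are
-- quotients of squares.
module Submission where

open import Defs
open import Algebra.Bundles using (CommutativeRing)
open import Data.Product using (∃; _,_)
open import Function.Base using (_∘_)
open import Function.Bundles using (_⇔_; mk⇔)
open import Relation.Binary.PropositionalEquality using (_≡_)
open import Relation.Nullary using (¬_)

module CommutativeRingSquares {c ℓ} (R : CommutativeRing c ℓ) where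
  open CommutativeRing R
  open import Algebra.Solver.Ring.NaturalCoefficients.Default commutativeSemiring
    using (solve; _:=_; _:+_; _:*_)
  open import Relation.Binary.Reasoning.Setoid setoid

  private
    two : Carrier
    two = 1# + 1#

  two*x≈x+x : ∀ x → two * x ≈ x + x
  two*x≈x+x x = trans (distribʳ x 1# 1#) (+-cong (*-identityˡ x) (*-identityˡ x))

  *-preserves-inverse : ∀ {u u′ v v′} → u * u′ ≈ 1# → v * v′ ≈ 1# → (u * v) * (u′ * v′) ≈ 1#
  *-preserves-inverse {u} {u′} {v} {v′} uu′≈1 vv′≈1 = begin
    (u * v) * (u′ * v′) ≈⟨ solve 4 (λ u u′ v v′ → (u :* v) :* (u′ :* v′) := (u :* u′) :* (v :* v′))
                                   refl u u′ v v′ ⟩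
    (u * u′) * (v * v′) ≈⟨ *-cong uu′≈1 vv′≈1 ⟩
    1# * 1#             ≈⟨ *-identityˡ 1# ⟩
    1#                  ∎

  square-of-quotient : ∀ {u v x z} → u * v ≈ 1# → (u * u) * x ≈ z * z → (z * v) * (z * v) ≈ x
  square-of-quotient {u} {v} {x} {z} uv≈1 u²x≈z² = begin
    (z * v) * (z * v)       ≈⟨ solve 2 (λ z v → (z :* v) :* (z :* v) := (z :* z) :* (v :* v)) refl z v ⟩
    (z * z) * (v * v)       ≈⟨ *-congʳ (sym u²x≈z²) ⟩
    ((u * u) * x) * (v * v) ≈⟨ solve 3 (λ u v x → ((u :* u) :* x) :* (v :* v) := x :* ((u :* v) :* (u :* v)))
                                       refl u v x ⟩
    x * ((u * v) * (u * v)) ≈⟨ *-congˡ (*-cong uv≈1 uv≈1) ⟩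
    x * (1# * 1#)           ≈⟨ *-congˡ (*-identityˡ 1#) ⟩
    x * 1#                  ≈⟨ *-identityʳ x ⟩
    x                       ∎

  root≉0 : ∀ {s a} → s * s ≈ a → ¬ a ≈ 0# → ¬ s ≈ 0#
  root≉0 {s} {a} s²≈a a≉0 s≈0 = a≉0 (begin
    a      ≈⟨ sym s²≈a ⟩
    s * s  ≈⟨ *-congʳ s≈0 ⟩
    0# * s ≈⟨ zeroˡ s ⟩
    0#     ∎)

  two≈0⇒a≈-b : ∀ {a b c} → two * c ≈ a + b → two ≈ 0# → a ≈ - b
  two≈0⇒a≈-b {a} {b} {c} 2c≈a+b two≈0 = begin
    a              ≈⟨ sym (+-identityʳ a) ⟩
    a + 0#         ≈⟨ +-congˡ (sym (-‿inverseʳ b)) ⟩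
    a + (b + - b)  ≈⟨ sym (+-assoc a b (- b)) ⟩
    (a + b) + - b  ≈⟨ +-congʳ (sym 2c≈a+b) ⟩
    two * c + - b  ≈⟨ +-congʳ (trans (*-congʳ two≈0) (zeroˡ c)) ⟩
    0# + - b       ≈⟨ +-identityˡ (- b) ⟩
    - b            ∎

  two-step-mean-square : ∀ {a b c d e} → two * c ≈ a + b → two * e ≈ c + d → d * d ≈ a * b
                       → (two * two) * (a * e) ≈ (a + d) * (a + d)
  two-step-mean-square {a} {b} {c} {d} {e} 2c≈a+b 2e≈c+d d²≈ab = begin
    (two * two) * (a * e)           ≈⟨ solve 3 (λ t a e → (t :* t) :* (a :* e) := (t :* a) :* (t :* e))
                                               refl two a e ⟩
    (two * a) * (two * e)           ≈⟨ *-congˡ 2e≈c+d ⟩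
    (two * a) * (c + d)             ≈⟨ solve 4 (λ t a c d → (t :* a) :* (c :+ d) := a :* (t :* c) :+ t :* (a :* d))
                                               refl two a c d ⟩
    a * (two * c) + two * (a * d)   ≈⟨ +-congʳ (*-congˡ 2c≈a+b) ⟩
    a * (a + b) + two * (a * d)     ≈⟨ +-cong (distribˡ a a b) (two*x≈x+x (a * d)) ⟩
    (a * a + a * b) + (a * d + a * d) ≈⟨ +-congʳ (+-congˡ (sym d²≈ab)) ⟩
    (a * a + d * d) + (a * d + a * d) ≈⟨ solve 2 (λ a d → (a :* a :+ d :* d) :+ (a :* d :+ a :* d)
                                                         := (a :+ d) :* (a :+ d)) refl a d ⟩
    (a + d) * (a + d)               ∎

module FiniteFieldSquares (F : FiniteField) where
  open FiniteField F
  open CommutativeRing ring hiding (ring)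
  open JGraph F
  open CommutativeRingSquares ring
  open import Algebra.Solver.Ring.NaturalCoefficients.Default commutativeSemiring
    using (solve; _:=_; _:*_)

  IsSquare-cancel-scaledˡ : ∀ {t x y z} → NonZero t → IsSquare x → (t * t) * (x * y) ≈ z * z
                          → NonZero y → IsSquare y
  IsSquare-cancel-scaledˡ {t} {x} {y} {z} t≉0 (x≉0 , s , s²≈x) t²xy≈z² y≉0 =
    let t′ , tt′≈1 = inverse t t≉0
        s′ , ss′≈1 = inverse s (root≉0 s²≈x x≉0)
    in y≉0 , z * (t′ * s′) ,
       square-of-quotient (*-preserves-inverse tt′≈1 ss′≈1) (trans [ts]²y≈t²xy t²xy≈z²)
    where
    [ts]²y≈t²xy : ((t * s) * (t * s)) * y ≈ (t * t) * (x * y)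
    [ts]²y≈t²xy = trans (solve 3 (λ t s y → (t :* s) :* (t :* s) :* y := (t :* t) :* ((s :* s) :* y))
                                 refl t s y)
                        (*-congˡ (*-congʳ s²≈x))

  IsSquare-cancelˡ : ∀ {x y} → IsSquare x → IsSquare (x * y) → NonZero y → IsSquare y
  IsSquare-cancelˡ {x} {y} x-square (_ , w , w²≈xy) =
    IsSquare-cancel-scaledˡ (0≉1 ∘ sym) x-square 1²xy≈w²
    where
    1²xy≈w² : (1# * 1#) * (x * y) ≈ w * w
    1²xy≈w² = trans (*-congʳ (*-identityˡ 1#)) (trans (*-identityˡ (x * y)) (sym w²≈xy))

  two-step-path-preserves-SquareVertex : ∀ {a b c d e f} → Edge a b c d → Edge c d e f
                                       → SquareVertex a b ⇔ SquareVertex e f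
  two-step-path-preserves-SquareVertex {a} {b} {c} {d} {e} {f}
    ((a≉0 , b≉0 , ab-square , _ , a≉-b) , _ , 2c≈a+b , d²≈ab)
    (_ , (e≉0 , f≉0 , ef-square , _) , 2e≈c+d , _) =
    mk⇔ to from
    where
    two≉0 : NonZero two
    two≉0 = a≉-b ∘ two≈0⇒a≈-b 2c≈a+b

    4ae≈[a+d]² : (two * two) * (a * e) ≈ (a + d) * (a + d)
    4ae≈[a+d]² = two-step-mean-square 2c≈a+b 2e≈c+d d²≈ab

    to : SquareVertex a b → SquareVertex e f
    to (a-square , _) = e-square , IsSquare-cancelˡ e-square ef-square f≉0
      where
      e-square : IsSquare e
      e-square = IsSquare-cancel-scaledˡ two≉0 a-square 4ae≈[a+d]² e≉0

    from : SquareVertex e f → SquareVertex a b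
    from (e-square , _) = a-square , IsSquare-cancelˡ a-square ab-square b≉0
      where
      a-square : IsSquare a
      a-square = IsSquare-cancel-scaledˡ two≉0 e-square
                   (trans (*-congˡ (*-comm e a)) 4ae≈[a+d]²) a≉0

open import Data.Nat using (suc; _*_)

lemma3p10 : (F : FiniteField)
    → (∃ λ k → FiniteField.card F ≡ suc (2 * k))
    → let open FiniteField F in
      let open CommutativeRing ring using (Carrier) in
      let open JGraph F in
      ∀ (a b c d e f : Carrier)
      → Edge a b c d → Edge c d e f
      → SquareVertex a b ⇔ SquareVertex e f
lemma3p10 F _ _ _ _ _ _ _ = FiniteFieldSquares.two-step-path-preserves-SquareVertex F
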